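{- Let $q,\alpha\ge1$ and let $(s,h)$, $(s',h')$ be memory states with support graphs $(V,E,A,\mathrm{Lab},\mathrm{Btw},\mathrm{Rem})$ and $(V',E',A',\mathrm{Lab}',\mathrm{Btw}',\mathrm{Rem}')$ (with respect to $q$). Then $(s,h)\approx^q_\alpha(s',h')$ if and only if there is a map $f:V\to V'$ such that: (A1) $f$ is a graph isomorphism between $(V,E)$ and $(V',E')$; (A2) for all $l\in V$, $l\in A$ iff $f(l)\in A'$; (A3) for all $l\in V$, $\mathrm{Lab}(l)=\mathrm{Lab}'(f(l))$; (A4) for all $(l,l')\in E$, $\min(\alpha,|\mathrm{Btw}(l,l')|)=\min(\alpha,|\mathrm{Btw}'(f(l),f(l'))|)$; (A5) $\min(\alpha,|\mathrm{Rem}|)=\min(\alpha,|\mathrm{Rem}'|)$.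
   Context: A memory state is $(s,h)$ with $s:\mathrm{PVAR}\to\mathrm{LOC}$ (program variables $x_1,x_2,\dots$) and $h$ a partial function $\mathrm{LOC}\to\mathrm{LOC}$ with finite domain. $h^0=\mathrm{id}$, $h^{n+1}(l)=h(h^n(l))$ when defined. Terms: $\mathrm{Terms}_q=\{x_1,\dots,x_q\}\cup\{m_q(x_i,x_j)\mid i,j\in\{1,\dots,q\}\}$. $[\![x_i]\!]^q_{s,h}=s(x_i)$; $[\![m_q(x_i,x_j)]\!]^q_{s,h}$ is the unique location $l$ (undefined if none) such that there are $L_1,L_2\ge0$ with $h^{L_1}(s(x_i))=h^{L_2}(s(x_j))=l$, for all $L_1'<L_1$ and $L_2'\ge0$, $h^{L_1'}(s(x_i))\neq h^{L_2'}(s(x_j))$, and there are $k\le q$, $L\ge0$ with $h^L(l)=s(x_k)$. $\mathrm{Labels}_q(s,h)$ is the set of defined values $[\![t]\!]^q_{s,h}$, $t\in\mathrm{Terms}_q$. Support graph $(V,E,A,\mathrm{Lab},\mathrm{Btw},\mathrm{Rem})$ of $(s,h)$: $V=\mathrm{Labels}_q(s,h)$; $(l,l')\in E$ iff $l,l'\in V$, there is $L\ge1$ with $h^L(l)=l'$ and $h^{L'}(l)\notin V$ for all $0<L'<L$; $A=V\cap\mathrm{dom}(h)$; $\mathrm{Lab}(l)=\{t\in\mathrm{Terms}_q\mid[\![t]\!]^q_{s,h}=l\}$; for $(l,l')\in E$, $\mathrm{Btw}(l,l')$ is the set of $l''$ such that there are $L,L'\ge1$ with $h^L(l)=l''$,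 $h^{L'}(l'')=l'$ and $h^{L''}(l)\notin V$ for all $L''\in[1,L]$; $\mathrm{Rem}=\mathrm{dom}(h)\setminus(A\cup\bigcup_{(l,l')\in E}\mathrm{Btw}(l,l'))$. $\mathrm{Test}(q,\alpha)$ consists of the formulas $t=t'$, $\mathrm{alloc}(t)$, $t\hookrightarrow t'$, $\mathrm{sees}_q(t,t')\ge\beta+1$, $\mathrm{sizeR}_q\ge\beta$ for $t,t'\in\mathrm{Terms}_q$, $\beta\in\{1,\dots,\alpha\}$, with semantics: $t=t'$ iff some $l\in V$ has $\{t,t'\}\subseteq\mathrm{Lab}(l)$; $\mathrm{alloc}(t)$ iff some $l\in A$ has $t\in\mathrm{Lab}(l)$; $t\hookrightarrow t'$ iff some $(l,l')\in E$ has $t\in\mathrm{Lab}(l)$, $t'\in\mathrm{Lab}(l')$, $|\mathrm{Btw}(l,l')|=0$; $\mathrm{sees}_q(t,t')\ge\beta+1$ iff some $(l,l')\in E$ has $t\in\mathrm{Lab}(l)$, $t'\in\mathrm{Lab}(l')$, $|\mathrm{Btw}(l,l')|\ge\beta$; $\mathrm{sizeR}_q\ge\beta$ iff $|\mathrm{Rem}|\ge\beta$. We write $(s,h)\approx^q_\alpha(s',h')$ iff $(s,h)$ and $(s',h')$ satisfy exactly the same formulas of $\mathrm{Test}(q,\alpha)$. -}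

module Defs where

open import Data.Nat using (ℕ; zero; suc; _≤_; _<_; _⊓_)
open import Data.Fin using (Fin; toℕ)
open import Data.Maybe using (Maybe; just; nothing; Is-just; _>>=_)
open import Data.List using (List; length)
open import Data.List.Membership.Propositional using (_∈_)
open import Data.List.Relation.Unary.Unique.Propositional using (Unique)
open import Data.Product using (Σ; ∃; ∃-syntax; _×_; _,_)
open import Relation.Nullary using (¬_)
open import Relation.Binary.PropositionalEquality using (_≡_)
open import Function.Bundles using (_⇔_)

LOC : Set
LOC = ℕ

-- Stores: program variable x_{k+1} is represented by the index k
Store : Set
Store = ℕ → LOC

record Heap : Set where
  field
    _!_ : LOC → Maybe LOC
    finiteDom : ∃[ ls ] (∀ l → Is-just (_!_ l) → l ∈ ls)
open Heap public

record MemState : Set where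
  constructor ⟨_,_⟩
  field
    sto : Store
    hp  : Heap
open MemState public

iter : Heap → ℕ → LOC → Maybe LOC
iter h zero    l = just l
iter h (suc n) l = iter h n l >>= (h !_)

HasCard : (LOC → Set) → ℕ → Set
HasCard P n = Σ (List LOC) λ xs → Unique xs × length xs ≡ n × (∀ l → (l ∈ xs ⇔ P l))

data Term (q : ℕ) : Set where
  var  : Fin q → Term q
  meet : Fin q → Fin q → Term q

module _ (q : ℕ) (σ : MemState) where
  private
    s = sto σ
    h = hp σ
    x : Fin q → LOC
    x i = s (toℕ i)

  IsMeet : Fin q → Fin q → LOC → Set
  IsMeet i j l =
    (∃[ L₁ ] ∃[ L₂ ]
       (iter h L₁ (x i) ≡ just l × iter h L₂ (x j) ≡ just l ×
        (∀ L₁' → L₁' < L₁ → ∀ L₂' l'' → iter h L₁' (x i) ≡ just l'' → ¬ (iter h L₂' (x j) ≡ just l''))))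
    × (∃[ k ] ∃[ L ] iter h L l ≡ just (x k))

  Denot : Term q → LOC → Set
  Denot (var i)    l = l ≡ x i
  Denot (meet i j) l = IsMeet i j l × (∀ l' → IsMeet i j l' → l' ≡ l)

  V : LOC → Set
  V l = ∃[ t ] Denot t l

  E : LOC → LOC → Set
  E l l' = V l × V l' ×
    (∃[ L ] (1 ≤ L × iter h L l ≡ just l' ×
       (∀ L' → 1 ≤ L' → L' < L → ¬ (∃[ l'' ] (iter h L' l ≡ just l'' × V l'')))))

  A : LOC → Set
  A l = V l × Is-just (h ! l)

  Lab : LOC → Term q → Set
  Lab l t = Denot t l

  Btw : LOC → LOC → LOC → Set
  Btw l l' l'' = ∃[ L ] ∃[ L' ] (1 ≤ L × 1 ≤ L' × iter h L l ≡ just l'' × iter h L' l'' ≡ just l' ×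
    (∀ L'' → 1 ≤ L'' → L'' ≤ L → ¬ (∃[ m ] (iter h L'' l ≡ just m × V m))))

  Rem : LOC → Set
  Rem l'' = Is-just (h ! l'') × ¬ A l'' × ¬ (∃[ l ] ∃[ l' ] (E l l' × Btw l l' l''))

data Test (q α : ℕ) : Set where
  eqT    : Term q → Term q → Test q α
  allocT : Term q → Test q α
  ptsT   : Term q → Term q → Test q α
  -- sees_q(t,t') ≥ β+1, with β ∈ {1,…,α}
  seesT  : Term q → Term q → (β : ℕ) → 1 ≤ β → β ≤ α → Test q α
  sizeRT : (β : ℕ) → 1 ≤ β → β ≤ α → Test q α

Sat : (q α : ℕ) → MemState → Test q α → Set
Sat q α σ (eqT t t')   = ∃[ l ] (V q σ l × Lab q σ l t × Lab q σ l t')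
Sat q α σ (allocT t)   = ∃[ l ] (A q σ l × Lab q σ l t)
Sat q α σ (ptsT t t')  = ∃[ l ] ∃[ l' ] (E q σ l l' × Lab q σ l t × Lab q σ l' t' × HasCard (Btw q σ l l') 0)
Sat q α σ (seesT t t' β _ _) = ∃[ l ] ∃[ l' ] (E q σ l l' × Lab q σ l t × Lab q σ l' t' ×
                                 ∃[ n ] (HasCard (Btw q σ l l') n × β ≤ n))
Sat q α σ (sizeRT β _ _) = ∃[ n ] (HasCard (Rem q σ) n × β ≤ n)

_≈[_,_]_ : MemState → ℕ → ℕ → MemState → Set
σ ≈[ q , α ] σ' = ∀ (φ : Test q α) → (Sat q α σ φ ⇔ Sat q α σ' φ)

-- Conditions (A1)–(A5) on a map f : V → V'  (represented as LOC → LOC,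
-- only its values on V matter)

module _ (q α : ℕ) (σ σ' : MemState) (f : LOC → LOC) where

  A1 : Set
  A1 = (∀ l → V q σ l → V q σ' (f l))
     × (∀ l l₁ → V q σ l → V q σ l₁ → f l ≡ f l₁ → l ≡ l₁)
     × (∀ l' → V q σ' l' → ∃[ l ] (V q σ l × f l ≡ l'))
     × (∀ l l₁ → V q σ l → V q σ l₁ → (E q σ l l₁ ⇔ E q σ' (f l) (f l₁)))

  A2 : Set
  A2 = ∀ l → V q σ l → (A q σ l ⇔ A q σ' (f l))

  A3 : Set
  A3 = ∀ l → V q σ l → ∀ t → (Lab q σ l t ⇔ Lab q σ' (f l) t)

  A4 : Set
  A4 = ∀ l l₁ → E q σ l l₁ →
       ∃[ n ] ∃[ n' ] (HasCard (Btw q σ l l₁) n × HasCard (Btw q σ' (f l) (f l₁)) n' × α ⊓ n ≡ α ⊓ n')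

  A5 : Set
  A5 = ∃[ n ] ∃[ n' ] (HasCard (Rem q σ) n × HasCard (Rem q σ') n' × α ⊓ n ≡ α ⊓ n')

-- Each test of Test(q, α) sees the support graph only through labels, so a label-preserving
-- isomorphism that also preserves allocation and the counts |Btw| and |Rem| truncated at α
-- transfers every test. Conversely, a term denotes at most one location, so the tests t = t
-- send each l ∈ V to the unique location f(l) of σ' carrying the same labels; equality tests
-- make f bijective, t ↪ t' and sees(t, t') ≥ 2 detect edges, and the thresholds sees ≥ β + 1
-- and sizeR ≥ β for β ≤ α fix min(α, ·) of the counts. These counts exist because every
-- component of the support graph is decidable: a heap path can be shortened to at most
-- |dom h| steps by cutting out a repeated location (pigeonhole).

module Submission where

open import Defs
open import Data.Nat using (ℕ; zero; suc; _+_; _≤_; _<_; _⊓_; z≤n; s≤s; _≟_; _≤?_; _<?_)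
open import Data.Nat.Properties
  using (≤-refl; ≤-trans; ≤-reflexive; ≤-antisym; <⇒≤; ≮⇒≥; m≤n⇒m<n∨m≡n; ≤-pred; m≤n⇒∃[o]m+o≡n;
         +-comm; +-monoʳ-<; <-cmp; ⊓-glb; m⊓n≤m; m⊓n≤n; anyUpTo?; allUpTo?)
open import Data.Nat.Induction using (<-rec)
open import Data.Fin using (Fin; toℕ)
open import Data.Fin.Properties using (pigeonhole; toℕ<n; any?)
open import Data.Maybe using (Maybe; just; nothing; Is-just; _>>=_)
open import Data.Maybe.Properties using (≡-dec; just-injective)
import Data.Maybe.Relation.Unary.Any as MaybeAny
open import Data.List using (List; length; lookup; filter; deduplicate)
open import Data.List.Membership.Propositional using (_∈_)
open import Data.List.Membership.Propositional.Properties using (∈-filter⁺; ∈-filter⁻; deduplicate-∈⇔)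
open import Data.List.Membership.Propositional.Properties.WithK using (unique∧set⇒bag)
open import Data.List.Relation.Unary.Any using (index)
open import Data.List.Relation.Unary.Any.Properties using (lookup-index)
open import Data.List.Relation.Unary.Unique.DecPropositional.Properties _≟_ using (deduplicate-!)
open import Data.List.Relation.Binary.BagAndSetEquality using (∼bag⇒↭)
open import Data.List.Relation.Binary.Permutation.Propositional.Properties using (↭-length)
open import Data.Unit using (tt)
open import Data.Product using (∃; ∃-syntax; _×_; _,_; proj₁; proj₂)
open import Data.Sum using (inj₁; inj₂)
open import Data.Empty using (⊥-elim)
open import Relation.Nullary using (¬_; Dec; yes; no; contradiction; ¬?; _×-dec_; _→-dec_)
open import Relation.Nullary.Decidable using (map′)
open import Relation.Unary using (Decidable)
open import Relation.Binary using (tri<; tri≈; tri>)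
open import Relation.Binary.PropositionalEquality using (_≡_; refl; sym; trans; cong; subst; subst₂)
open import Function.Bundles using (_⇔_; mk⇔; Equivalence)
open import Function.Properties.Equivalence using () renaming (trans to ⇔-trans; sym to ⇔-sym)

open Equivalence

HasCard-unique : ∀ {P : LOC → Set} {m n} → HasCard P m → HasCard P n → m ≡ n
HasCard-unique (xs , xs! , refl , xs⇔P) (ys , ys! , refl , ys⇔P) =
  ↭-length (∼bag⇒↭ (unique∧set⇒bag xs! ys! λ {l} → ⇔-trans (xs⇔P l) (⇔-sym (ys⇔P l))))

HasCard-exists : ∀ {P : LOC → Set} → Decidable P → (ys : List LOC) → (∀ l → P l → l ∈ ys) → ∃ (HasCard P)
HasCard-exists {P} P? ys P⊆ys =
  length zs , zs , deduplicate-! (filter P? ys) , refl ,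
  λ l → mk⇔ (λ l∈zs → proj₂ (∈-filter⁻ P? {xs = ys} (from (deduplicate-∈⇔ _≟_) l∈zs)))
            (λ Pl → to (deduplicate-∈⇔ _≟_) (∈-filter⁺ P? (P⊆ys l Pl) Pl))
  where zs = deduplicate _≟_ (filter P? ys)

AtLeast : (LOC → Set) → ℕ → Set
AtLeast P β = ∃[ n ] (HasCard P n × β ≤ n)

AtLeast-transfer : ∀ {α β n n'} {P P' : LOC → Set} → HasCard P n → HasCard P' n' → α ⊓ n ≡ α ⊓ n' →
                   β ≤ α → AtLeast P β → AtLeast P' β
AtLeast-transfer {α} {n' = n'} Pn P'n' ⊓≡ β≤α (k , Pk , β≤k) =
  n' , P'n' , ≤-trans (⊓-glb β≤α (subst (_ ≤_) (HasCard-unique Pk Pn) β≤k))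
                      (≤-trans (≤-reflexive ⊓≡) (m⊓n≤n α n'))

⊓-mono-thresholds : ∀ {α m n} → (∀ β → 1 ≤ β → β ≤ α → β ≤ m → β ≤ n) → α ⊓ m ≤ α ⊓ n
⊓-mono-thresholds {α} {m} above with α ⊓ m | m⊓n≤m α m | m⊓n≤n α m
... | zero  | _   | _   = z≤n
... | suc k | k<α | k<m = ⊓-glb k<α (above (suc k) (s≤s z≤n) k<α k<m)

⊓-≡-from-AtLeast : ∀ {α n n'} {P P' : LOC → Set} → HasCard P n → HasCard P' n' →
                   (∀ β → 1 ≤ β → β ≤ α → AtLeast P β → AtLeast P' β) →
                   (∀ β → 1 ≤ β → β ≤ α → AtLeast P' β → AtLeast P β) → α ⊓ n ≡ α ⊓ n'
⊓-≡-from-AtLeast Pn P'n' P⇒P' P'⇒P = ≤-antisym (⊓-mono-thresholds (threshold Pn P'n' P⇒P'))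
                                               (⊓-mono-thresholds (threshold P'n' Pn P'⇒P))
  where
  threshold : ∀ {α n n'} {P P'} → HasCard P n → HasCard P' n' →
              (∀ β → 1 ≤ β → β ≤ α → AtLeast P β → AtLeast P' β) →
              ∀ β → 1 ≤ β → β ≤ α → β ≤ n → β ≤ n'
  threshold Pn P'n' P⇒P' β 1≤β β≤α β≤n =
    let (k , P'k , β≤k) = P⇒P' β 1≤β β≤α (_ , Pn , β≤n) in subst (β ≤_) (HasCard-unique P'k P'n') β≤k

HasCard-zero-transfer : ∀ {α n n'} {P P' : LOC → Set} → 1 ≤ α → HasCard P n → HasCard P' n' →
                        α ⊓ n ≡ α ⊓ n' → HasCard P 0 → HasCard P' 0
HasCard-zero-transfer {n' = zero}  _   _  P'0 _ _ = P'0
HasCard-zero-transfer {n' = suc k} 1≤α Pn P'n' ⊓≡ P0 =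
  let (m , Pm , 1≤m) = AtLeast-transfer P'n' Pn (sym ⊓≡) 1≤α (suc k , P'n' , s≤s z≤n)
  in contradiction (subst (1 ≤_) (HasCard-unique Pm P0) 1≤m) λ ()

∃-bounded? : ∀ {P : ℕ → Set} → Decidable P → (B : ℕ) → (∀ n → P n → ∃[ m ] (m < B × P m)) → Dec (∃ P)
∃-bounded? P? B bounded = map′ (λ (n , _ , Pn) → n , Pn) (λ (n , Pn) → bounded n Pn) (anyUpTo? P? B)

∀-between? : ∀ {P : ℕ → Set} → Decidable P → (v : ℕ) → Dec (∀ n → 1 ≤ n → n < v → P n)
∀-between? {P} P? v = map′ below-to-between between-to-below (allUpTo? (λ n → (1 ≤? n) →-dec P? n) v)
  where
  below-to-between : (∀ {n} → n < v → 1 ≤ n → P n) → ∀ n → 1 ≤ n → n < v → P n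
  below-to-between all n 1≤n n<v = all n<v 1≤n
  between-to-below : (∀ n → 1 ≤ n → n < v → P n) → ∀ {n} → n < v → 1 ≤ n → P n
  between-to-below all n<v 1≤n = all _ 1≤n n<v

Least : (ℕ → Set) → ℕ → Set
Least P m = P m × ∀ k → k < m → ¬ P k

least-witness : ∀ {P : ℕ → Set} → Decidable P → ∀ n → P n → ∃ (Least P)
least-witness {P} P? = <-rec (λ n → P n → ∃ (Least P)) step
  where
  step : ∀ n → (∀ {m} → m < n → P m → ∃ (Least P)) → P n → ∃ (Least P)
  step n smaller Pn with anyUpTo? P? n
  ... | yes (m , m<n , Pm) = smaller m<n Pm
  ... | no none            = n , Pn , λ k k<n Pk → none (k , k<n , Pk)

just-satisfies? : ∀ {A : Set} {Q : A → Set} → Decidable Q → (ma : Maybe A) → Dec (∃[ a ] (ma ≡ just a × Q a))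
just-satisfies? Q? nothing  = no λ ()
just-satisfies? Q? (just a) = map′ (λ Qa → a , refl , Qa) (λ { (_ , refl , Qa) → Qa }) (Q? a)

>>=-just : ∀ {A B : Set} {ma : Maybe A} {f : A → Maybe B} {b} → (ma >>= f) ≡ just b →
           ∃[ a ] (ma ≡ just a × f a ≡ just b)
>>=-just {ma = just a} e = a , refl , e

module _ (h : Heap) where

  domain : List LOC
  domain = proj₁ (finiteDom h)

  iter-+ : ∀ m {n a c} → iter h n a ≡ just c → iter h (m + n) a ≡ iter h m c
  iter-+ zero    e = e
  iter-+ (suc m) e = cong (_>>= (h !_)) (iter-+ m e)

  iter-cut : ∀ d {i j a b c} → iter h i a ≡ just c → iter h j a ≡ just c → iter h (d + j) a ≡ just b →
             iter h (d + i) a ≡ just b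
  iter-cut d eᵢ eⱼ e = trans (iter-+ d eᵢ) (trans (sym (iter-+ d eⱼ)) e)

  iter-prefix : ∀ {n} L {a b} → n ≤ L → iter h L a ≡ just b → ∃[ c ] iter h n a ≡ just c
  iter-prefix zero    z≤n e = _ , e
  iter-prefix (suc L) n≤L e with m≤n⇒m<n∨m≡n n≤L
  ... | inj₂ refl      = _ , e
  ... | inj₁ (s≤s n≤L) = iter-prefix L n≤L (proj₁ (proj₂ (>>=-just e)))

  iter-∈-domain : ∀ {k L a b} → k < L → iter h L a ≡ just b → ∃[ c ] (iter h k a ≡ just c × c ∈ domain)
  iter-∈-domain {L = L} k<L e with iter-prefix L k<L e
  ... | _ , eₖ₊₁ with >>=-just eₖ₊₁
  ... | c , eₖ , hc = c , eₖ , proj₂ (finiteDom h) c (subst Is-just (sym hc) (MaybeAny.just tt))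

  iter⁺-source-∈-domain : ∀ {L a b} → 1 ≤ L → iter h L a ≡ just b → a ∈ domain
  iter⁺-source-∈-domain 1≤L e with iter-∈-domain 1≤L e
  ... | _ , refl , a∈ = a∈

  iter-repeats : ∀ K {a b} → length domain ≤ K → iter h (suc K) a ≡ just b →
                 ∃[ i ] ∃[ j ] ∃[ c ] (i < j × j ≤ K × iter h i a ≡ just c × iter h j a ≡ just c)
  iter-repeats K {a} N≤K e =
    let (i , j , i<j , same-position) = pigeonhole (s≤s N≤K) position
    in toℕ i , toℕ j , location i , i<j , ≤-pred (toℕ<n j) ,
       reaches i , subst (λ c → iter h (toℕ j) a ≡ just c) (sym (same-location {i} {j} same-position)) (reaches j)
    where
    visit : (k : Fin (suc K)) → ∃[ c ] (iter h (toℕ k) a ≡ just c × c ∈ domain)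
    visit k = iter-∈-domain (toℕ<n k) e
    location : Fin (suc K) → LOC
    location k = proj₁ (visit k)
    reaches : (k : Fin (suc K)) → iter h (toℕ k) a ≡ just (location k)
    reaches k = proj₁ (proj₂ (visit k))
    position : Fin (suc K) → Fin (length domain)
    position k = index (proj₂ (proj₂ (visit k)))
    same-location : ∀ {i j} → position i ≡ position j → location i ≡ location j
    same-location {i} {j} p = trans (lookup-index (proj₂ (proj₂ (visit i))))
                                    (trans (cong (lookup domain) p) (sym (lookup-index (proj₂ (proj₂ (visit j))))))

  ShortPath : ℕ → LOC → LOC → Set
  ShortPath K a b = ∃[ K₀ ] (K₀ ≤ K × K₀ < length domain × iter h (suc K₀) a ≡ just b)

  iter-shorten : ∀ K {a b} → iter h (suc K) a ≡ just b → ShortPath K a b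
  iter-shorten = <-rec _ shorten
    where
    shorten : ∀ K → (∀ {K'} → K' < K → ∀ {a b} → iter h (suc K') a ≡ just b → ShortPath K' a b) →
              ∀ {a b} → iter h (suc K) a ≡ just b → ShortPath K a b
    shorten K shorter {a} {b} e with K <? length domain
    ... | yes K<N = K , ≤-refl , K<N , e
    ... | no K≮N with iter-repeats K (≮⇒≥ K≮N) e
    ... | i , j , _ , i<j , j≤K , eᵢ , eⱼ with m≤n⇒∃[o]m+o≡n j≤K
    ... | d , refl =
      let K'<K = subst (d + i <_) (+-comm d j) (+-monoʳ-< d i<j)
          e'   = subst (λ L → iter h L a ≡ just b) (cong suc (+-comm j d)) e
          (K₀ , K₀≤K' , K₀<N , e₀) = shorter K'<K (iter-cut (suc d) eᵢ eⱼ e')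
      in K₀ , ≤-trans K₀≤K' (<⇒≤ K'<K) , K₀<N , e₀

  iter≟ : ∀ n a b → Dec (iter h n a ≡ just b)
  iter≟ n a b = ≡-dec _≟_ (iter h n a) (just b)

  iter-bounded : ∀ L {a b} → iter h L a ≡ just b → ∃[ L₀ ] (L₀ < suc (length domain) × iter h L₀ a ≡ just b)
  iter-bounded zero    e = 0 , s≤s z≤n , e
  iter-bounded (suc K) e = let (K₀ , _ , K₀<N , e₀) = iter-shorten K e in suc K₀ , s≤s K₀<N , e₀

  Reachable? : ∀ a b → Dec (∃[ L ] iter h L a ≡ just b)
  Reachable? a b = ∃-bounded? (λ L → iter≟ L a b) (suc (length domain)) (λ L → iter-bounded L)

  ∃-iter⁺? : ∀ {Q : ℕ → Set} → Decidable Q → (∀ {m n} → m ≤ n → Q n → Q m) → ∀ a b →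
             Dec (∃[ L ] (1 ≤ L × iter h L a ≡ just b × Q L))
  ∃-iter⁺? {Q} Q? Q-downward a b =
    ∃-bounded? (λ L → (1 ≤? L) ×-dec (iter≟ L a b ×-dec Q? L)) (suc (length domain)) bounded
    where
    bounded : ∀ L → 1 ≤ L × iter h L a ≡ just b × Q L →
              ∃[ L₀ ] (L₀ < suc (length domain) × 1 ≤ L₀ × iter h L₀ a ≡ just b × Q L₀)
    bounded (suc K) (_ , e , QL) =
      let (K₀ , K₀≤K , K₀<N , e₀) = iter-shorten K e
      in suc K₀ , s≤s K₀<N , s≤s z≤n , e₀ , Q-downward (s≤s K₀≤K) QL

any-Term? : ∀ {q} {Q : Term q → Set} → Decidable Q → Dec (∃ Q)
any-Term? Q? with any? (λ i → Q? (var i)) | any? (λ i → any? (λ j → Q? (meet i j)))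
... | yes (i , Qi) | _                  = yes (var i , Qi)
... | no _         | yes (i , j , Qij)  = yes (meet i j , Qij)
... | no ¬var      | no ¬meet           = no λ { (var i , Qi) → ¬var (i , Qi) ; (meet i j , Qij) → ¬meet (i , j , Qij) }

module _ (q : ℕ) (σ : MemState) where
  private
    h = hp σ
    x : Fin q → LOC
    x i = sto σ (toℕ i)

  FirstCommon : Fin q → Fin q → LOC → Set
  FirstCommon i j l = ∃[ L₁ ] ∃[ L₂ ] (iter h L₁ (x i) ≡ just l × iter h L₂ (x j) ≡ just l ×
    (∀ L₁' → L₁' < L₁ → ∀ L₂' l'' → iter h L₁' (x i) ≡ just l'' → ¬ (iter h L₂' (x j) ≡ just l'')))

  FirstCommon-unique : ∀ {i j l l'} → FirstCommon i j l → FirstCommon i j l' → l ≡ l'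
  FirstCommon-unique {l = l} {l'} (L₁ , L₂ , e₁ , e₂ , first) (L₁' , L₂' , e₁' , e₂' , first')
    with <-cmp L₁ L₁'
  ... | tri< L₁<L₁' _ _ = ⊥-elim (first' L₁ L₁<L₁' L₂ l e₁ e₂)
  ... | tri≈ _ refl _   = just-injective (trans (sym e₁) e₁')
  ... | tri> _ _ L₁'<L₁ = ⊥-elim (first L₁' L₁'<L₁ L₂' l' e₁' e₂')

  CommonAt : Fin q → Fin q → ℕ → Set
  CommonAt i j k = ∃[ m ] (iter h k (x i) ≡ just m × ∃[ L ] iter h L (x j) ≡ just m)

  CommonAt? : ∀ i j → Decidable (CommonAt i j)
  CommonAt? i j k = just-satisfies? (Reachable? h (x j)) (iter h k (x i))

  CommonAt-bounded : ∀ i j k → CommonAt i j k → ∃[ k₀ ] (k₀ < suc (length (domain h)) × CommonAt i j k₀)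
  CommonAt-bounded i j k (m , e , reach) = let (k₀ , k₀<N , e₀) = iter-bounded h k e in k₀ , k₀<N , m , e₀ , reach

  FirstCommon? : ∀ i j → Dec (∃ (FirstCommon i j))
  FirstCommon? i j with ∃-bounded? (CommonAt? i j) (suc (length (domain h))) (CommonAt-bounded i j)
  ... | no ∄common = no λ (l , L₁ , L₂ , e₁ , e₂ , _) → ∄common (L₁ , l , e₁ , L₂ , e₂)
  ... | yes (k , common) with least-witness (CommonAt? i j) k common
  ... | k₀ , (m , e₁ , L₂ , e₂) , below =
    yes (m , k₀ , L₂ , e₁ , e₂ , λ L₁' L₁'<k₀ L₂' l'' e e' → below L₁' L₁'<k₀ (l'' , e , L₂' , e'))

  IsMeet? : ∀ i j → Dec (∃ (IsMeet q σ i j))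
  IsMeet? i j with FirstCommon? i j
  ... | no ∄first       = no λ (l , first , _) → ∄first (l , first)
  ... | yes (m , first) =
    map′ (λ reaches → m , first , reaches)
         (λ (l , first' , reaches) →
            subst (λ l → ∃[ k ] ∃[ L ] iter h L l ≡ just (x k)) (FirstCommon-unique first' first) reaches)
         (any? (λ k → Reachable? h m (x k)))

  denot-functional : ∀ t {l l'} → Denot q σ t l → Denot q σ t l' → l ≡ l'
  denot-functional (var i)    d            d'            = trans d (sym d')
  denot-functional (meet i j) (_ , unique) (isMeet' , _) = sym (unique _ isMeet')

  Denot-∃? : ∀ t → Dec (∃ (Denot q σ t))
  Denot-∃? (var i)    = yes (x i , refl)
  Denot-∃? (meet i j) =
    map′ (λ (m , isMeet) → m , isMeet , λ l isMeet' → FirstCommon-unique (proj₁ isMeet') (proj₁ isMeet))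
         (λ (m , isMeet , _) → m , isMeet)
         (IsMeet? i j)

  Denot? : ∀ t l → Dec (Denot q σ t l)
  Denot? t l with Denot-∃? t
  ... | no ∄denot   = no λ d → ∄denot (l , d)
  ... | yes (m , d) = map′ (λ { refl → d }) (λ d' → denot-functional t d' d) (l ≟ m)

  V? : Decidable (V q σ)
  V? l = any-Term? (λ t → Denot? t l)

  ∃V? : ∀ {Q : LOC → Set} → Decidable Q → Dec (∃[ l ] (V q σ l × Q l))
  ∃V? {Q} Q? = map′ (λ (t , l , d , Ql) → l , (t , d) , Ql) (λ (l , (t , d) , Ql) → t , l , d , Ql)
                    (any-Term? denotation-satisfies?)
    where
    denotation-satisfies? : ∀ t → Dec (∃[ l ] (Denot q σ t l × Q l))
    denotation-satisfies? t with Denot-∃? t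
    ... | no ∄denot   = no λ (l , d , _) → ∄denot (l , d)
    ... | yes (m , d) = map′ (λ Qm → m , d , Qm) (λ (l , d' , Ql) → subst Q (denot-functional t d' d) Ql) (Q? m)

  Avoids : ℕ → LOC → Set
  Avoids v l = ∀ L → 1 ≤ L → L < v → ¬ (∃[ m ] (iter h L l ≡ just m × V q σ m))

  Avoids? : ∀ v l → Dec (Avoids v l)
  Avoids? v l = ∀-between? (λ L → ¬? (just-satisfies? V? (iter h L l))) v

  Avoids-downward : ∀ {l m n} → m ≤ n → Avoids n l → Avoids m l
  Avoids-downward m≤n avoids L 1≤L L<m = avoids L 1≤L (≤-trans L<m m≤n)

  E? : ∀ l l' → Dec (E q σ l l')
  E? l l' = V? l ×-dec (V? l' ×-dec ∃-iter⁺? h (λ L → Avoids? L l) Avoids-downward l l')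

  Btw? : ∀ l l' l'' → Dec (Btw q σ l l' l'')
  Btw? l l' l'' =
    map′ (λ ((L , 1≤L , e , avoids) , (L' , 1≤L' , e' , _)) →
            L , L' , 1≤L , 1≤L' , e , e' , λ L'' 1≤L'' L''≤L → avoids L'' 1≤L'' (s≤s L''≤L))
         (λ (L , L' , 1≤L , 1≤L' , e , e' , avoids) →
            (L , 1≤L , e , λ L'' 1≤L'' L''<L → avoids L'' 1≤L'' (≤-pred L''<L)) , (L' , 1≤L' , e' , tt))
         (∃-iter⁺? h (λ L → Avoids? (suc L) l) (λ m≤n → Avoids-downward (s≤s m≤n)) l l''
          ×-dec ∃-iter⁺? h (λ _ → yes tt) (λ _ _ → tt) l'' l')

  allocated? : ∀ l → Dec (Is-just (h ! l))
  allocated? l = MaybeAny.dec (λ _ → yes tt) (h ! l)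

  A? : Decidable (A q σ)
  A? l = V? l ×-dec allocated? l

  Rem? : Decidable (Rem q σ)
  Rem? l = allocated? l ×-dec (¬? (A? l) ×-dec ¬? on-edge?)
    where
    on-edge? : Dec (∃[ l₁ ] ∃[ l₂ ] (E q σ l₁ l₂ × Btw q σ l₁ l₂ l))
    on-edge? = map′ (λ (l₁ , _ , l₂ , _ , on) → l₁ , l₂ , on)
                    (λ (l₁ , l₂ , on@((v₁ , v₂ , _) , _)) → l₁ , v₁ , l₂ , v₂ , on)
                    (∃V? λ l₁ → ∃V? λ l₂ → E? l₁ l₂ ×-dec Btw? l₁ l₂ l)

  Btw-card : ∀ l l' → ∃ (HasCard (Btw q σ l l'))
  Btw-card l l' = HasCard-exists (Btw? l l') (domain h)
                    λ _ (_ , _ , _ , 1≤L' , _ , e' , _) → iter⁺-source-∈-domain h 1≤L' e'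

  Rem-card : ∃ (HasCard (Rem q σ))
  Rem-card = HasCard-exists Rem? (domain h) λ l (allocated , _) → proj₂ (finiteDom h) l allocated

isomorphism⇒≈ : ∀ q α → 1 ≤ α → (σ σ' : MemState) (f : LOC → LOC) → A1 q α σ σ' f → A2 q α σ σ' f →
                A3 q α σ σ' f → A4 q α σ σ' f → A5 q α σ σ' f → σ ≈[ q , α ] σ'
isomorphism⇒≈ q α 1≤α σ σ' f (f-V , _ , f-onto , f-E) f-A f-Lab f-Btw f-Rem φ = mk⇔ (forth φ) (back φ)
  where
  f-edge : ∀ {l l₁} → E q σ l l₁ → E q σ' (f l) (f l₁)
  f-edge {l} {l₁} e@(v , v₁ , _) = to (f-E l l₁ v v₁) e

  f-denot : ∀ {l t} → V q σ l → Denot q σ t l → Denot q σ' t (f l)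
  f-denot {l} {t} v = to (f-Lab l v t)

  pull : ∀ {l' t} → V q σ' l' → Denot q σ' t l' → ∃[ l ] (V q σ l × f l ≡ l' × Denot q σ t l)
  pull {t = t} v' d' with f-onto _ v'
  ... | l , v , refl = l , v , refl , from (f-Lab l v t) d'

  pull-edge : ∀ {l' l₁' t t₁} → E q σ' l' l₁' → Denot q σ' t l' → Denot q σ' t₁ l₁' →
              ∃[ l ] ∃[ l₁ ] (E q σ l l₁ × Denot q σ t l × Denot q σ t₁ l₁ × f l ≡ l' × f l₁ ≡ l₁')
  pull-edge e'@(v' , v₁' , _) d' d₁' with pull v' d' | pull v₁' d₁'
  ... | l , v , refl , d | l₁ , v₁ , refl , d₁ = l , l₁ , from (f-E l l₁ v v₁) e' , d , d₁ , refl , refl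

  forth : ∀ φ → Sat q α σ φ → Sat q α σ' φ
  forth (eqT t t') (l , v , d , d') = f l , f-V l v , f-denot v d , f-denot v d'
  forth (allocT t) (l , a@(v , _) , d) = f l , to (f-A l v) a , f-denot v d
  forth (ptsT t t') (l , l₁ , e@(v , v₁ , _) , d , d₁ , empty) =
    let (_ , _ , Bn , B'n' , ⊓≡) = f-Btw l l₁ e
    in f l , f l₁ , f-edge e , f-denot v d , f-denot v₁ d₁ , HasCard-zero-transfer 1≤α Bn B'n' ⊓≡ empty
  forth (seesT t t' β _ β≤α) (l , l₁ , e@(v , v₁ , _) , d , d₁ , atLeast) =
    let (_ , _ , Bn , B'n' , ⊓≡) = f-Btw l l₁ e
    in f l , f l₁ , f-edge e , f-denot v d , f-denot v₁ d₁ , AtLeast-transfer Bn B'n' ⊓≡ β≤α atLeast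
  forth (sizeRT β _ β≤α) atLeast =
    let (_ , _ , Rn , R'n' , ⊓≡) = f-Rem in AtLeast-transfer Rn R'n' ⊓≡ β≤α atLeast

  back : ∀ φ → Sat q α σ' φ → Sat q α σ φ
  back (eqT t t') (_ , v' , d' , d'') with pull v' d'
  ... | l , v , refl , d = l , v , d , from (f-Lab l v t') d''
  back (allocT t) (_ , a'@(v' , _) , d') with pull v' d'
  ... | l , v , refl , d = l , from (f-A l v) a' , d
  back (ptsT t t') (_ , _ , e' , d' , d₁' , empty) with pull-edge e' d' d₁'
  ... | l , l₁ , e , d , d₁ , refl , refl =
    let (_ , _ , Bn , B'n' , ⊓≡) = f-Btw l l₁ e
    in l , l₁ , e , d , d₁ , HasCard-zero-transfer 1≤α B'n' Bn (sym ⊓≡) empty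
  back (seesT t t' β _ β≤α) (_ , _ , e' , d' , d₁' , atLeast) with pull-edge e' d' d₁'
  ... | l , l₁ , e , d , d₁ , refl , refl =
    let (_ , _ , Bn , B'n' , ⊓≡) = f-Btw l l₁ e
    in l , l₁ , e , d , d₁ , AtLeast-transfer B'n' Bn (sym ⊓≡) β≤α atLeast
  back (sizeRT β _ β≤α) atLeast =
    let (_ , _ , Rn , R'n' , ⊓≡) = f-Rem in AtLeast-transfer R'n' Rn (sym ⊓≡) β≤α atLeast

-- An edge is detected by t ↪ t₁ when nothing lies between its ends, and by sees(t, t₁) ≥ 2
-- otherwise; the latter test exists because α ≥ 1.
edge-transfer : ∀ {q α} → 1 ≤ α → {ρ ρ' : MemState} → (∀ φ → Sat q α ρ φ → Sat q α ρ' φ) →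
                ∀ {l l₁ t t₁} → E q ρ l l₁ → Denot q ρ t l → Denot q ρ t₁ l₁ →
                ∃[ m ] ∃[ m₁ ] (E q ρ' m m₁ × Denot q ρ' t m × Denot q ρ' t₁ m₁)
edge-transfer {q} 1≤α {ρ} sat⇒ {l} {l₁} {t} {t₁} e d d₁ with Btw-card q ρ l l₁
... | zero  , empty =
  let (m , m₁ , e' , dm , dm₁ , _) = sat⇒ (ptsT t t₁) (l , l₁ , e , d , d₁ , empty) in m , m₁ , e' , dm , dm₁
... | suc n , Bn =
  let (m , m₁ , e' , dm , dm₁ , _) =
        sat⇒ (seesT t t₁ 1 ≤-refl 1≤α) (l , l₁ , e , d , d₁ , suc n , Bn , s≤s z≤n)
  in m , m₁ , e' , dm , dm₁

module _ (q α : ℕ) (1≤α : 1 ≤ α) (σ σ' : MemState) (σ≈σ' : σ ≈[ q , α ] σ') where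
  private
    forth : ∀ φ → Sat q α σ φ → Sat q α σ' φ
    forth φ = to (σ≈σ' φ)

    back : ∀ φ → Sat q α σ' φ → Sat q α σ φ
    back φ = from (σ≈σ' φ)

    -- Off V the value of f is irrelevant.
    f : LOC → LOC
    f l with V? q σ l
    ... | yes (t , d) = proj₁ (forth (eqT t t) (l , (t , d) , d , d))
    ... | no _        = l

    f-denot : ∀ {l t} → V q σ l → Denot q σ t l → Denot q σ' t (f l)
    f-denot {l} {t} v d with V? q σ l
    ... | no ¬v = ⊥-elim (¬v v)
    ... | yes (t₀ , d₀) =
      let (_ , _ , d₀' , _)      = forth (eqT t₀ t₀) (l , (t₀ , d₀) , d₀ , d₀)
          (_ , _ , d₀'' , dt'') = forth (eqT t₀ t) (l , (t₀ , d₀) , d₀ , d)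
      in subst (Denot q σ' t) (denot-functional q σ' t₀ d₀'' d₀') dt''

    f-denot⁻ : ∀ {l t} → V q σ l → Denot q σ' t (f l) → Denot q σ t l
    f-denot⁻ {l} {t} v@(t₀ , d₀) d' =
      let d₀' = f-denot v d₀
          (_ , _ , d₀₂ , dt₂) = back (eqT t₀ t) (f l , (t₀ , d₀') , d₀' , d')
      in subst (Denot q σ t) (denot-functional q σ t₀ d₀₂ d₀) dt₂

    at-f : ∀ {l m t} → V q σ l → Denot q σ t l → Denot q σ' t m → m ≡ f l
    at-f {t = t} v d d' = denot-functional q σ' t d' (f-denot v d)

    f-V : ∀ l → V q σ l → V q σ' (f l)
    f-V l v@(t , d) = t , f-denot v d

    f-edge⇔ : ∀ l l₁ → V q σ l → V q σ l₁ → (E q σ l l₁ ⇔ E q σ' (f l) (f l₁))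
    f-edge⇔ l l₁ v@(t , d) v₁@(t₁ , d₁) = mk⇔
      (λ e → let (m , m₁ , e' , dm , dm₁) = edge-transfer 1≤α forth e d d₁
             in subst₂ (E q σ') (at-f v d dm) (at-f v₁ d₁ dm₁) e')
      (λ e' → let (m , m₁ , e , dm , dm₁) = edge-transfer 1≤α back e' (f-denot v d) (f-denot v₁ d₁)
              in subst₂ (E q σ) (denot-functional q σ t dm d) (denot-functional q σ t₁ dm₁ d₁) e)

    a1 : A1 q α σ σ' f
    a1 = f-V , injective , onto , f-edge⇔
      where
      injective : ∀ l l₁ → V q σ l → V q σ l₁ → f l ≡ f l₁ → l ≡ l₁
      injective l l₁ v@(t , d) v₁@(t₁ , d₁) fl≡fl₁ =
        let d' = f-denot v d
            d₁' = subst (Denot q σ' t₁) (sym fl≡fl₁) (f-denot v₁ d₁)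
            (m , _ , dm , dm₁) = back (eqT t t₁) (f l , (t , d') , d' , d₁')
        in trans (denot-functional q σ t d dm) (denot-functional q σ t₁ dm₁ d₁)
      onto : ∀ l' → V q σ' l' → ∃[ l ] (V q σ l × f l ≡ l')
      onto l' (t , d') = let (l , v , d , _) = back (eqT t t) (l' , (t , d') , d' , d') in l , v , sym (at-f v d d')

    a2 : A2 q α σ σ' f
    a2 l v@(t , d) = mk⇔
      (λ a → let (m , a' , dm) = forth (allocT t) (l , a , d) in subst (A q σ') (at-f v d dm) a')
      (λ a' → let (m , a , dm) = back (allocT t) (f l , a' , f-denot v d) in subst (A q σ) (denot-functional q σ t dm d) a)

    a3 : A3 q α σ σ' f
    a3 l v t = mk⇔ (f-denot v) (f-denot⁻ v)

    a4 : A4 q α σ σ' f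
    a4 l l₁ e@(v@(t , d) , v₁@(t₁ , d₁) , _) =
      let (n , Bn) = Btw-card q σ l l₁
          (n' , B'n') = Btw-card q σ' (f l) (f l₁)
      in n , n' , Bn , B'n' , ⊓-≡-from-AtLeast Bn B'n' sees-forth sees-back
      where
      sees-forth : ∀ β → 1 ≤ β → β ≤ α → AtLeast (Btw q σ l l₁) β → AtLeast (Btw q σ' (f l) (f l₁)) β
      sees-forth β 1≤β β≤α atLeast =
        let (m , m₁ , _ , dm , dm₁ , atLeast') = forth (seesT t t₁ β 1≤β β≤α) (l , l₁ , e , d , d₁ , atLeast)
        in subst₂ (λ a b → AtLeast (Btw q σ' a b) β) (at-f v d dm) (at-f v₁ d₁ dm₁) atLeast'
      sees-back : ∀ β → 1 ≤ β → β ≤ α → AtLeast (Btw q σ' (f l) (f l₁)) β → AtLeast (Btw q σ l l₁) β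
      sees-back β 1≤β β≤α atLeast' =
        let (m , m₁ , _ , dm , dm₁ , atLeast) =
              back (seesT t t₁ β 1≤β β≤α)
                   (f l , f l₁ , to (f-edge⇔ l l₁ v v₁) e , f-denot v d , f-denot v₁ d₁ , atLeast')
        in subst₂ (λ a b → AtLeast (Btw q σ a b) β)
                  (denot-functional q σ t dm d) (denot-functional q σ t₁ dm₁ d₁) atLeast

    a5 : A5 q α σ σ' f
    a5 = let (n , Rn) = Rem-card q σ
             (n' , R'n') = Rem-card q σ'
         in n , n' , Rn , R'n' ,
            ⊓-≡-from-AtLeast Rn R'n' (λ β 1≤β β≤α → forth (sizeRT β 1≤β β≤α))
                                     (λ β 1≤β β≤α → back (sizeRT β 1≤β β≤α))

  ≈⇒isomorphism : ∃[ f ] (A1 q α σ σ' f × A2 q α σ σ' f × A3 q α σ σ' f × A4 q α σ σ' f × A5 q α σ σ' f)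
  ≈⇒isomorphism = f , a1 , a2 , a3 , a4 , a5

lemma4p7 : (q α : ℕ) → 1 ≤ q → 1 ≤ α → (σ σ' : MemState) →
    (σ ≈[ q , α ] σ') ⇔
    (∃[ f ] (A1 q α σ σ' f × A2 q α σ σ' f × A3 q α σ σ' f × A4 q α σ σ' f × A5 q α σ σ' f))
lemma4p7 q α _ 1≤α σ σ' = mk⇔
  (≈⇒isomorphism q α 1≤α σ σ')
  (λ (f , a1 , a2 , a3 , a4 , a5) → isomorphism⇒≈ q α 1≤α σ σ' f a1 a2 a3 a4 a5)
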